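{- Let $D=(V,E)$ be a simple $r$-regular digraph with $n$ vertices and $m$ arcs. Then, as an identity of rational functions in $\lambda$, $$A( \lambda, D^{ -0- }) = \lambda^{m-n}(1-\lambda)^n\, \frac{\lambda^2 - \lambda (n - r - 1) + 2m - mn - r}{\lambda^2 + \lambda (r+1)- r}\, A\!\left(\frac{\lambda^2 + \lambda}{1 - \lambda}, D\right).$$
   Context: A simple digraph is $D=(V,E)$ with $V$ finite nonempty and $E\subseteq\{(u,v)\in V\times V: u\neq v\}$; for an arc $e=(u,v)$, $t(e)=u$ and $h(e)=v$. $D$ is $r$-regular if every vertex has in-degree and out-degree $r$. $A(\lambda,G)=\det(\lambda I-A(G))$ with $A(G)$ the 0/1 adjacency matrix. $D^{ -0- }$ is the digraph on vertex set $V\cup E$ (disjoint union) whose arcs are: all $(u,v)$ with $u,v\in V$, $u\neq v$, $(u,v)\notin E$; all $(v,e)$ with $v\in V$, $e\in E$, $v\neq t(e)$; and all $(e,v)$ with $e\in E$, $v\in V$, $v\neq h(e)$ (no arcs among vertices of $E$). -}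

module Defs where

open import Data.Nat as ℕ using (ℕ; zero; suc)
open import Data.Integer as ℤ using (ℤ; +_; -[1+_])
open import Data.Rational as ℚ using (ℚ; 0ℚ; 1ℚ; _+_; _*_; _-_; -_; 1/_; ≢-nonZero)
open import Data.Fin as Fin using (Fin; splitAt; punchIn; toℕ)
open import Data.Fin.Properties using (any?)
open import Data.Product using (_×_; proj₁; proj₂; _,_)
open import Data.Sum using (inj₁; inj₂)
open import Data.Bool using (Bool; true; false; if_then_else_; not; _∧_)
open import Relation.Nullary.Decidable using (⌊_⌋; _×-dec_)
open import Relation.Binary.PropositionalEquality using (_≡_; _≢_)
open import Function.Definitions using (Injective)

ℕ→ℚ : ℕ → ℚ
ℕ→ℚ k = + k ℚ./ 1

infixr 8 _^_
_^_ : ℚ → ℕ → ℚ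
x ^ zero  = 1ℚ
x ^ suc k = x * (x ^ k)

powℤ : (x : ℚ) → x ≢ 0ℚ → ℤ → ℚ
powℤ x h (+ k)     = x ^ k
powℤ x h -[1+ k ]  = ((1/ x) {{≢-nonZero h}}) ^ suc k

sumFin : (k : ℕ) → (Fin k → ℚ) → ℚ
sumFin zero    f = 0ℚ
sumFin (suc k) f = f Fin.zero + sumFin k (λ i → f (Fin.suc i))

countFin : (k : ℕ) → (Fin k → Bool) → ℕ
countFin zero    p = 0
countFin (suc k) p = (if p Fin.zero then 1 else 0) ℕ.+ countFin k (λ i → p (Fin.suc i))

det : (k : ℕ) → (Fin k → Fin k → ℚ) → ℚ
det zero    M = 1ℚ
det (suc k) M =
  sumFin (suc k) (λ j → ((- 1ℚ) ^ toℕ j) * (M Fin.zero j * det k (λ a b → M (Fin.suc a) (punchIn j b))))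

bool→ℚ : Bool → ℚ
bool→ℚ true  = 1ℚ
bool→ℚ false = 0ℚ

eqFin : {k : ℕ} → Fin k → Fin k → Bool
eqFin i j = ⌊ i Fin.≟ j ⌋

charPolyMat : (k : ℕ) → (Fin k → Fin k → Bool) → ℚ → ℚ
charPolyMat k A x = det k (λ i j → (if eqFin i j then x else 0ℚ) - bool→ℚ (A i j))

record Digraph : Set where
  field
    n m      : ℕ
    arc      : Fin m → Fin n × Fin n
    arc-inj  : Injective _≡_ _≡_ arc
    loopless : ∀ e → proj₁ (arc e) ≢ proj₂ (arc e)

  t : Fin m → Fin n
  t e = proj₁ (arc e)

  h : Fin m → Fin n
  h e = proj₂ (arc e)

  isArc : Fin n → Fin n → Bool
  isArc u v = ⌊ any? (λ e → (t e Fin.≟ u) ×-dec (h e Fin.≟ v)) ⌋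

  adj : Fin n → Fin n → Bool
  adj = isArc

  outdeg : Fin n → ℕ
  outdeg v = countFin m (λ e → eqFin (t e) v)

  indeg : Fin n → ℕ
  indeg v = countFin m (λ e → eqFin (h e) v)

open Digraph public

Regular : ℕ → Digraph → Set
Regular r D = ∀ v → outdeg D v ≡ r × indeg D v ≡ r

charPoly : (D : Digraph) → ℚ → ℚ
charPoly D x = charPolyMat (n D) (adj D) x

-- adjacency matrix of D^{-0-}, vertex set V ⊎ E encoded as Fin (n + m)
-- (first n indices = vertices of D, last m indices = arcs of D)
adjM0M : (D : Digraph) → Fin (n D ℕ.+ m D) → Fin (n D ℕ.+ m D) → Bool
adjM0M D i j with splitAt (n D) i | splitAt (n D) j
... | inj₁ u | inj₁ v = not (eqFin u v) ∧ not (isArc D u v)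
... | inj₁ v | inj₂ e = not (eqFin v (t D e))
... | inj₂ e | inj₁ v = not (eqFin v (h D e))
... | inj₂ e | inj₂ f = false

charPolyM0M : (D : Digraph) → ℚ → ℚ
charPolyM0M D x = charPolyMat (n D ℕ.+ m D) (adjM0M D) x

module Submission where

-- Order the vertices of D^{-0-} as V then E, so that x·I − A(D^{-0-}) has blocks
--   [[ x·I − (J − I − A(D)),  −(J − T) ],  [ −(J − H),  x·I ]]
-- where T, H are the tail and head incidence matrices.  The Schur complement of
-- the scalar arc block gives  x^n · A(x, D^{-0-}) = x^m · det S  with
--   S = x·(x·I − (J − I − A)) − (J − T)(J − H)ᵀ = (1 − x)(y·I − A) + g·J,
-- y = (x² + x)/(1 − x), g = 2r − m − x, by counting with regularity.  As the
-- columns of P = (1 − x)(y·I − A) sum to s = x² + (r + 1)x − r, the matrix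
-- determinant lemma for J gives  det (P + g·J) · s = (s + n g) · det P, and
-- det P = (1 − x)^n A(y, D); dividing by x^n and s yields the theorem.

open import Defs

open import Algebra.Bundles using (CommutativeRing)
open import Data.Bool using (Bool; true; false; if_then_else_; not; _∧_)
open import Data.Bool.Properties using (∧-conicalˡ; ∧-conicalʳ; ∧-identityʳ)
open import Data.Empty using (⊥-elim)
open import Data.Fin as Fin using (Fin; punchIn; punchOut; toℕ; fromℕ; fromℕ<; inject₁; _↑ˡ_; _↑ʳ_)
import Data.Fin.Properties as FinP
open import Data.Fin.Properties using (any?)
open import Data.Integer as ℤ using (+_; _⊖_) renaming (_-_ to _-ℤ_)
import Data.Integer.Properties as ℤP
open import Data.Nat as ℕ using (ℕ; zero; suc; _≤_; _<_)
import Data.Nat.Coprimality as Coprime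
import Data.Nat.Properties as ℕP
open import Data.Product using (_,_; proj₁; proj₂)
open import Data.Sum using (inj₁; inj₂)
open import Data.Rational as ℚ using (ℚ; 0ℚ; 1ℚ; ½; mkℚ; _+_; _*_; _-_; -_; 1/_; _÷_; ≢-nonZero)
import Data.Rational.Properties as ℚP
open import Data.Rational.Solver using (module +-*-Solver)
import Data.Rational.Unnormalised as ℚᵘ
import Data.Rational.Unnormalised.Properties as ℚᵘP
open import Data.Vec.Functional using (insertAt)
open import Data.Vec.Functional.Properties using (insertAt-lookup; insertAt-punchIn)
open import Function using (_∘_)
open import Relation.Nullary using (yes; no; _×-dec_)
open import Relation.Nullary.Decidable using (isYes≗does; dec-true; dec-false)
open import Relation.Binary.PropositionalEquality

open import Algebra.Properties.Group ℚP.+-0-group using (inverseʳ-unique)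
open import Algebra.Properties.Semiring.Sum (CommutativeRing.semiring ℚP.+-*-commutativeRing)
  using (sum; sum-cong-≗; sum-replicate-zero; sum-init-last; sum-remove; ∑-distrib-+; ∑-comm; *-distribˡ-sum; *-distribʳ-sum)

open +-*-Solver

-- ℕ→ℚ k = k/1 is a normalised fraction; successor is checked on unnormalised
-- representatives.
ℕ→ℚ-suc : ∀ k → ℕ→ℚ (suc k) ≡ 1ℚ + ℕ→ℚ k
ℕ→ℚ-suc k = trans (normal (suc k)) (trans (ℚP.toℚᵘ-injective agree) (cong (λ z → 1ℚ + z) (sym (normal k))))
  where
  canonical : ℕ → ℚ
  canonical j = mkℚ (+ j) 0 (Coprime.sym (Coprime.1-coprimeTo j))
  normal : ∀ j → ℕ→ℚ j ≡ canonical j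
  normal j = ℚP.↥p/↧p≡p (canonical j)
  agree : ℚ.toℚᵘ (canonical (suc k)) ℚᵘ.≃ ℚ.toℚᵘ (1ℚ + canonical k)
  agree = ℚᵘP.≃-sym (ℚᵘP.≃-trans (ℚP.toℚᵘ-homo-+ 1ℚ (canonical k))
            (ℚᵘ.*≡* (cong (λ z → (+ 1 ℤ.+ z) ℤ.* + 1) (ℤP.*-identityʳ (+ k)))))

sumFin≡sum : ∀ k (f : Fin k → ℚ) → sumFin k f ≡ sum f
sumFin≡sum zero    f = refl
sumFin≡sum (suc k) f = cong (λ z → f Fin.zero + z) (sumFin≡sum k (f ∘ Fin.suc))

Σ-cong : ∀ k {f g : Fin k → ℚ} → (∀ i → f i ≡ g i) → sumFin k f ≡ sumFin k g
Σ-cong k {f} {g} f≗g = trans (sumFin≡sum k f) (trans (sum-cong-≗ f≗g) (sym (sumFin≡sum k g)))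

Σ-+ : ∀ k (f g : Fin k → ℚ) → sumFin k (λ i → f i + g i) ≡ sumFin k f + sumFin k g
Σ-+ k f g = trans (sumFin≡sum k _)
  (trans (∑-distrib-+ f g) (sym (cong₂ _+_ (sumFin≡sum k f) (sumFin≡sum k g))))

Σ-*ˡ : ∀ k c (f : Fin k → ℚ) → c * sumFin k f ≡ sumFin k (λ i → c * f i)
Σ-*ˡ k c f = trans (cong (c *_) (sumFin≡sum k f)) (trans (*-distribˡ-sum c f) (sym (sumFin≡sum k _)))

Σ-*ʳ : ∀ k c (f : Fin k → ℚ) → sumFin k f * c ≡ sumFin k (λ i → f i * c)
Σ-*ʳ k c f = trans (cong (_* c) (sumFin≡sum k f)) (trans (*-distribʳ-sum c f) (sym (sumFin≡sum k _)))

Σ-linear : ∀ k a b (f g : Fin k → ℚ) →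
  sumFin k (λ i → a * f i + b * g i) ≡ a * sumFin k f + b * sumFin k g
Σ-linear k a b f g = trans (Σ-+ k _ _) (sym (cong₂ _+_ (Σ-*ˡ k a f) (Σ-*ˡ k b g)))

Σ-neg : ∀ k (f : Fin k → ℚ) → sumFin k (λ i → - f i) ≡ - sumFin k f
Σ-neg zero    f = refl
Σ-neg (suc k) f = trans (cong (λ z → - f Fin.zero + z) (Σ-neg k (f ∘ Fin.suc)))
                        (sym (ℚP.neg-distrib-+ (f Fin.zero) (sumFin k (f ∘ Fin.suc))))

Σ-- : ∀ k (f g : Fin k → ℚ) → sumFin k (λ i → f i - g i) ≡ sumFin k f - sumFin k g
Σ-- k f g = trans (Σ-+ k f (λ i → - g i)) (cong (λ z → sumFin k f + z) (Σ-neg k g))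

Σ-swap : ∀ a b (f : Fin a → Fin b → ℚ) →
  sumFin a (λ i → sumFin b (f i)) ≡ sumFin b (λ j → sumFin a (λ i → f i j))
Σ-swap a b f = trans (asSum a b f) (trans (∑-comm f) (sym (asSum b a (λ j i → f i j))))
  where
  asSum : ∀ a b (f : Fin a → Fin b → ℚ) → sumFin a (λ i → sumFin b (f i)) ≡ sum (λ i → sum (f i))
  asSum a b f = trans (Σ-cong a (λ i → sumFin≡sum b (f i))) (sumFin≡sum a _)

Σ-zero : ∀ k (f : Fin k → ℚ) → (∀ i → f i ≡ 0ℚ) → sumFin k f ≡ 0ℚ
Σ-zero k f f≗0 = trans (Σ-cong k f≗0) (trans (sumFin≡sum k _) (sum-replicate-zero k))

Σ-delta : ∀ k (i : Fin k) (f : Fin k → ℚ) → (∀ j → j ≢ i → f j ≡ 0ℚ) → sumFin k f ≡ f i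
Σ-delta (suc k) i f off-i = begin
  sumFin (suc k) f                ≡⟨ sumFin≡sum (suc k) f ⟩
  sum f                           ≡⟨ sum-remove {i = i} f ⟩
  f i + sum (f ∘ punchIn i)       ≡⟨ cong (λ z → f i + z) (trans (sym (sumFin≡sum k _)) (Σ-zero k _ rest)) ⟩
  f i + 0ℚ                        ≡⟨ ℚP.+-identityʳ (f i) ⟩
  f i                             ∎
  where
  open ≡-Reasoning
  rest : ∀ j → f (punchIn i j) ≡ 0ℚ
  rest j = off-i (punchIn i j) (FinP.punchInᵢ≢i i j)

Σ-insertZero : ∀ k (j : Fin (suc k)) (g : Fin k → ℚ) → sumFin (suc k) (insertAt g j 0ℚ) ≡ sumFin k g
Σ-insertZero k j g = begin
  sumFin (suc k) G                          ≡⟨ sumFin≡sum (suc k) G ⟩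
  sum G                                     ≡⟨ sum-remove {i = j} G ⟩
  G j + sum (G ∘ punchIn j)                 ≡⟨ cong₂ _+_ (insertAt-lookup g j 0ℚ) (sum-cong-≗ (insertAt-punchIn g j 0ℚ)) ⟩
  0ℚ + sum g                                ≡⟨ ℚP.+-identityˡ (sum g) ⟩
  sum g                                     ≡⟨ sym (sumFin≡sum k g) ⟩
  sumFin k g                                ∎
  where
  open ≡-Reasoning
  G = insertAt g j 0ℚ

Σ-last : ∀ k (f : Fin (suc k) → ℚ) → sumFin (suc k) f ≡ sumFin k (f ∘ inject₁) + f (fromℕ k)
Σ-last k f = trans (sumFin≡sum (suc k) f)
  (trans (sum-init-last f) (cong (λ z → z + f (fromℕ k)) (sym (sumFin≡sum k (f ∘ inject₁)))))

Σ-split : ∀ a b (f : Fin (a ℕ.+ b) → ℚ) →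
  sumFin (a ℕ.+ b) f ≡ sumFin a (λ i → f (i ↑ˡ b)) + sumFin b (λ j → f (a ↑ʳ j))
Σ-split zero    b f = sym (ℚP.+-identityˡ _)
Σ-split (suc a) b f = trans (cong (λ z → f Fin.zero + z) (Σ-split a b (f ∘ Fin.suc)))
  (sym (ℚP.+-assoc (f Fin.zero) (sumFin a (λ i → f (Fin.suc i ↑ˡ b))) (sumFin b (λ j → f (suc a ↑ʳ j)))))

Σ-const : ∀ k c → sumFin k (λ _ → c) ≡ ℕ→ℚ k * c
Σ-const zero    c = sym (ℚP.*-zeroˡ c)
Σ-const (suc k) c = begin
  c + sumFin k (λ _ → c)   ≡⟨ cong (λ z → c + z) (Σ-const k c) ⟩
  c + ℕ→ℚ k * c            ≡⟨ solve 2 (λ c n → c :+ n :* c := (con 1ℚ :+ n) :* c) refl c (ℕ→ℚ k) ⟩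
  (1ℚ + ℕ→ℚ k) * c         ≡⟨ cong (_* c) (sym (ℕ→ℚ-suc k)) ⟩
  ℕ→ℚ (suc k) * c          ∎
  where open ≡-Reasoning

Σ-bool : ∀ k (p : Fin k → Bool) → sumFin k (λ i → bool→ℚ (p i)) ≡ ℕ→ℚ (countFin k p)
Σ-bool zero    p = refl
Σ-bool (suc k) p with p Fin.zero
... | true  = trans (cong (λ z → 1ℚ + z) (Σ-bool k (p ∘ Fin.suc))) (sym (ℕ→ℚ-suc (countFin k (p ∘ Fin.suc))))
... | false = trans (cong (λ z → 0ℚ + z) (Σ-bool k (p ∘ Fin.suc))) (ℚP.+-identityˡ _)

Mat : ℕ → Set
Mat k = Fin k → Fin k → ℚ

sgn : ℕ → ℚ
sgn t = (- 1ℚ) ^ t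

minor : ∀ {k} → Mat (suc k) → Fin (suc k) → Mat k
minor M j a b = M (Fin.suc a) (punchIn j b)

expTerm : ∀ {k} → Mat (suc k) → Fin (suc k) → ℚ
expTerm {k} M j = sgn (toℕ j) * (M Fin.zero j * det k (minor M j))

det-cong : ∀ k {M N : Mat k} → (∀ a b → M a b ≡ N a b) → det k M ≡ det k N
det-cong zero    M≗N = refl
det-cong (suc k) M≗N = Σ-cong (suc k) λ j →
  cong₂ (λ u v → sgn (toℕ j) * (u * v)) (M≗N Fin.zero j) (det-cong k (λ a b → M≗N (Fin.suc a) (punchIn j b)))

SameOff : ∀ {k} → Fin k → Mat k → Mat k → Set
SameOff i M N = ∀ r → r ≢ i → ∀ c → M r c ≡ N r c

det-rowLinear : ∀ k (i : Fin k) a b (M M₁ M₂ : Mat k) → SameOff i M₁ M → SameOff i M₂ M →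
  (∀ c → M i c ≡ a * M₁ i c + b * M₂ i c) → det k M ≡ a * det k M₁ + b * det k M₂
det-rowLinear (suc k) Fin.zero a b M M₁ M₂ same₁ same₂ row =
  trans (Σ-cong (suc k) term) (Σ-linear (suc k) a b (expTerm M₁) (expTerm M₂))
  where
  term : ∀ j → expTerm M j ≡ a * expTerm M₁ j + b * expTerm M₂ j
  term j = begin
    s * (M Fin.zero j * d)                       ≡⟨ cong (λ u → s * (u * d)) (row j) ⟩
    s * ((a * x₁ + b * x₂) * d)                  ≡⟨ solve 6 (λ s a b x₁ x₂ d → s :* ((a :* x₁ :+ b :* x₂) :* d)
                                                      := a :* (s :* (x₁ :* d)) :+ b :* (s :* (x₂ :* d))) refl s a b x₁ x₂ d ⟩
    a * (s * (x₁ * d)) + b * (s * (x₂ * d))      ≡⟨ cong₂ (λ d₁ d₂ → a * (s * (x₁ * d₁)) + b * (s * (x₂ * d₂))) (sameMinor same₁) (sameMinor same₂) ⟩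
    a * expTerm M₁ j + b * expTerm M₂ j          ∎
    where
    open ≡-Reasoning
    s = sgn (toℕ j)
    x₁ = M₁ Fin.zero j
    x₂ = M₂ Fin.zero j
    d = det k (minor M j)
    sameMinor : ∀ {N} → SameOff Fin.zero N M → d ≡ det k (minor N j)
    sameMinor same = det-cong k (λ r c → sym (same (Fin.suc r) (λ ()) (punchIn j c)))
det-rowLinear (suc k) (Fin.suc i) a b M M₁ M₂ same₁ same₂ row =
  trans (Σ-cong (suc k) term) (Σ-linear (suc k) a b (expTerm M₁) (expTerm M₂))
  where
  term : ∀ j → expTerm M j ≡ a * expTerm M₁ j + b * expTerm M₂ j
  term j = begin
    s * (x * det k (minor M j))                  ≡⟨ cong (λ u → s * (x * u)) minorLinear ⟩
    s * (x * (a * d₁ + b * d₂))                  ≡⟨ solve 6 (λ s a b x d₁ d₂ → s :* (x :* (a :* d₁ :+ b :* d₂))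
                                                      := a :* (s :* (x :* d₁)) :+ b :* (s :* (x :* d₂))) refl s a b x d₁ d₂ ⟩
    a * (s * (x * d₁)) + b * (s * (x * d₂))      ≡⟨ cong₂ (λ x₁ x₂ → a * (s * (x₁ * d₁)) + b * (s * (x₂ * d₂)))
                                                      (sym (same₁ Fin.zero (λ ()) j)) (sym (same₂ Fin.zero (λ ()) j)) ⟩
    a * expTerm M₁ j + b * expTerm M₂ j          ∎
    where
    open ≡-Reasoning
    s = sgn (toℕ j)
    x = M Fin.zero j
    d₁ = det k (minor M₁ j)
    d₂ = det k (minor M₂ j)
    suc≢ : ∀ {r} → r ≢ i → Fin.suc r ≢ Fin.suc i
    suc≢ r≢i = r≢i ∘ FinP.suc-injective
    minorLinear : det k (minor M j) ≡ a * d₁ + b * d₂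
    minorLinear = det-rowLinear k i a b (minor M j) (minor M₁ j) (minor M₂ j)
      (λ r r≢i c → same₁ (Fin.suc r) (suc≢ r≢i) (punchIn j c))
      (λ r r≢i c → same₂ (Fin.suc r) (suc≢ r≢i) (punchIn j c))
      (λ c → row (punchIn j c))

det-rowAdd : ∀ k (i : Fin k) (M M₁ M₂ : Mat k) → SameOff i M₁ M → SameOff i M₂ M →
  (∀ c → M i c ≡ M₁ i c + M₂ i c) → det k M ≡ det k M₁ + det k M₂
det-rowAdd k i M M₁ M₂ same₁ same₂ row =
  trans (det-rowLinear k i 1ℚ 1ℚ M M₁ M₂ same₁ same₂ (λ c → trans (row c) (one+one (M₁ i c) (M₂ i c))))
        (sym (one+one (det k M₁) (det k M₂)))
  where
  one+one : ∀ u v → u + v ≡ 1ℚ * u + 1ℚ * v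
  one+one u v = solve 2 (λ u v → u :+ v := con 1ℚ :* u :+ con 1ℚ :* v) refl u v

det-rowScale : ∀ k (i : Fin k) a (M M₁ : Mat k) → SameOff i M₁ M →
  (∀ c → M i c ≡ a * M₁ i c) → det k M ≡ a * det k M₁
det-rowScale k i a M M₁ same row =
  trans (det-rowLinear k i a 0ℚ M M₁ M₁ same same (λ c → trans (row c) (plusZero a (M₁ i c))))
        (sym (plusZero a (det k M₁)))
  where
  plusZero : ∀ a u → a * u ≡ a * u + 0ℚ * u
  plusZero a u = solve 2 (λ a u → a :* u := a :* u :+ con 0ℚ :* u) refl a u

setRow : ∀ {k} → Mat k → Fin k → (Fin k → ℚ) → Mat k
setRow M i v r c with r FinP.≟ i
... | yes _ = v c
... | no  _ = M r c

setRow-row : ∀ {k} (M : Mat k) i v c → setRow M i v i c ≡ v c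
setRow-row M i v c with i FinP.≟ i
... | yes _   = refl
... | no  i≢i = ⊥-elim (i≢i refl)

setRow-cong : ∀ {k} (M N : Mat k) i v r c → M r c ≡ N r c → setRow M i v r c ≡ setRow N i v r c
setRow-cong M N i v r c Mrc≡Nrc with r FinP.≟ i
... | yes _ = refl
... | no  _ = Mrc≡Nrc

setRow-off : ∀ {k} (M : Mat k) i v → SameOff i (setRow M i v) M
setRow-off M i v r r≢i c with r FinP.≟ i
... | yes r≡i = ⊥-elim (r≢i r≡i)
... | no  _   = refl

setRows : ∀ {k} → Mat k → Fin k → Fin k → (u v : Fin k → ℚ) → Mat k
setRows M i i' u v = setRow (setRow M i u) i' v

module _ {k} (M : Mat k) {i i' : Fin k} (i≢i' : i ≢ i') (u v : Fin k → ℚ) where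

  setRows-i : ∀ c → setRows M i i' u v i c ≡ u c
  setRows-i c = trans (setRow-off (setRow M i u) i' v i i≢i' c) (setRow-row M i u c)

  setRows-i' : ∀ c → setRows M i i' u v i' c ≡ v c
  setRows-i' = setRow-row (setRow M i u) i' v

  setRows-other : ∀ r → r ≢ i → r ≢ i' → ∀ c → setRows M i i' u v r c ≡ M r c
  setRows-other r r≢i r≢i' c = trans (setRow-off (setRow M i u) i' v r r≢i' c) (setRow-off M i u r r≢i c)

rows-ext : ∀ {k} (M N : Mat k) (i i' : Fin k) → (∀ c → M i c ≡ N i c) → (∀ c → M i' c ≡ N i' c) →
  (∀ r → r ≢ i → r ≢ i' → ∀ c → M r c ≡ N r c) → ∀ r c → M r c ≡ N r c
rows-ext M N i i' row-i row-i' other r c with r FinP.≟ i | r FinP.≟ i'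
... | yes refl | _        = row-i c
... | no  _    | yes refl = row-i' c
... | no  r≢i  | no r≢i'  = other r r≢i r≢i' c

Alternating : ℕ → Set
Alternating k = ∀ (M : Mat k) i i' → i ≢ i' → (∀ c → M i c ≡ M i' c) → det k M ≡ 0ℚ

self-negating : ∀ a → a ≡ - a → a ≡ 0ℚ
self-negating a a≡-a = begin
  a              ≡⟨ solve 1 (λ a → a := con ½ :* (a :+ a)) refl a ⟩
  ½ * (a + a)    ≡⟨ cong (λ z → ½ * (a + z)) a≡-a ⟩
  ½ * (a + - a)  ≡⟨ solve 1 (λ a → con ½ :* (a :+ :- a) := con 0ℚ) refl a ⟩
  0ℚ             ∎
  where open ≡-Reasoning

Σ²-antisym : ∀ k (G : Fin k → Fin k → ℚ) → (∀ j c → G j c ≡ - G c j) →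
  sumFin k (λ j → sumFin k (G j)) ≡ 0ℚ
Σ²-antisym k G antisym = self-negating S (begin
  S                                                 ≡⟨ Σ-cong k (λ j → Σ-cong k (antisym j)) ⟩
  sumFin k (λ j → sumFin k (λ c → - G c j))         ≡⟨ Σ-cong k (λ j → Σ-neg k (λ c → G c j)) ⟩
  sumFin k (λ j → - sumFin k (λ c → G c j))         ≡⟨ Σ-neg k _ ⟩
  - sumFin k (λ j → sumFin k (λ c → G c j))         ≡⟨ cong -_ (Σ-swap k k (λ j c → G c j)) ⟩
  - S                                               ∎)
  where
  open ≡-Reasoning
  S = sumFin k (λ j → sumFin k (G j))

-- Deleting columns j and c in either order: the combined sign of the two
-- deleted positions changes sign ...
sgn-pairAntisym : ∀ {k} (j c : Fin (suc k)) (j≢c : j ≢ c) (c≢j : c ≢ j) →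
  sgn (toℕ j) * sgn (toℕ (punchOut j≢c)) ≡ - (sgn (toℕ c) * sgn (toℕ (punchOut c≢j)))
sgn-pairAntisym Fin.zero Fin.zero j≢c _ = ⊥-elim (j≢c refl)
sgn-pairAntisym {suc k} Fin.zero (Fin.suc c) _ _ =
  solve 1 (λ s → con 1ℚ :* s := :- ((con (- 1ℚ) :* s) :* con 1ℚ)) refl (sgn (toℕ c))
sgn-pairAntisym {suc k} (Fin.suc j) Fin.zero _ _ =
  solve 1 (λ s → (con (- 1ℚ) :* s) :* con 1ℚ := :- (con 1ℚ :* s)) refl (sgn (toℕ j))
sgn-pairAntisym {suc k} (Fin.suc j) (Fin.suc c) j≢c c≢j = begin
  (- 1ℚ * a) * (- 1ℚ * b)   ≡⟨ solve 2 (λ a b → (con (- 1ℚ) :* a) :* (con (- 1ℚ) :* b) := a :* b) refl a b ⟩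
  a * b                     ≡⟨ sgn-pairAntisym j c (j≢c ∘ cong Fin.suc) (c≢j ∘ cong Fin.suc) ⟩
  - (a' * b')               ≡⟨ cong -_ (solve 2 (λ a b → a :* b := (con (- 1ℚ) :* a) :* (con (- 1ℚ) :* b)) refl a' b') ⟩
  - ((- 1ℚ * a') * (- 1ℚ * b')) ∎
  where
  open ≡-Reasoning
  a = sgn (toℕ j)
  b = sgn (toℕ (punchOut (j≢c ∘ cong Fin.suc)))
  a' = sgn (toℕ c)
  b' = sgn (toℕ (punchOut (c≢j ∘ cong Fin.suc)))

-- ... while the remaining columns are the same.
punchIn²-comm : ∀ {k} (j c : Fin (suc (suc k))) (j≢c : j ≢ c) (c≢j : c ≢ j) (b : Fin k) →
  punchIn j (punchIn (punchOut j≢c) b) ≡ punchIn c (punchIn (punchOut c≢j) b)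
punchIn²-comm Fin.zero Fin.zero j≢c _ b = ⊥-elim (j≢c refl)
punchIn²-comm Fin.zero (Fin.suc c) _ _ b = refl
punchIn²-comm (Fin.suc j) Fin.zero _ _ b = refl
punchIn²-comm (Fin.suc j) (Fin.suc c) _ _ Fin.zero = refl
punchIn²-comm (Fin.suc j) (Fin.suc c) j≢c c≢j (Fin.suc b) =
  cong Fin.suc (punchIn²-comm j c (j≢c ∘ cong Fin.suc) (c≢j ∘ cong Fin.suc) b)

-- Rows 0 and 1 equal ⇒ det = 0.  Expanding along rows 0 and 1 writes det M
-- as a double sum over the ordered pair (j, c) of deleted columns, and the
-- summand is antisymmetric in (j, c) because the two rows are equal.
det-equalRows01 : ∀ k (M : Mat (suc (suc k))) → (∀ c → M Fin.zero c ≡ M (Fin.suc Fin.zero) c) →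
  det (suc (suc k)) M ≡ 0ℚ
det-equalRows01 k M row0≡row1 = begin
  det (suc (suc k)) M                                         ≡⟨ Σ-cong (suc (suc k)) expandTwice ⟩
  sumFin (suc (suc k)) (λ j → sumFin (suc k) (F j))           ≡⟨ Σ-cong (suc (suc k)) (λ j → sym (Σ-insertZero (suc k) j (F j))) ⟩
  sumFin (suc (suc k)) (λ j → sumFin (suc (suc k)) (G j))     ≡⟨ Σ²-antisym (suc (suc k)) G G-antisym ⟩
  0ℚ                                                          ∎
  where
  open ≡-Reasoning
  row0 = Fin.zero
  row1 = Fin.suc Fin.zero
  D : Fin (suc (suc k)) → Fin (suc k) → ℚ
  D j l = det k (λ a b → M (Fin.suc (Fin.suc a)) (punchIn j (punchIn l b)))
  F : Fin (suc (suc k)) → Fin (suc k) → ℚ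
  F j l = sgn (toℕ j) * (M row0 j * (sgn (toℕ l) * (M row1 (punchIn j l) * D j l)))
  expandTwice : ∀ j → expTerm M j ≡ sumFin (suc k) (F j)
  expandTwice j = trans (cong (sgn (toℕ j) *_) (Σ-*ˡ (suc k) (M row0 j) (expTerm (minor M j))))
                        (Σ-*ˡ (suc k) (sgn (toℕ j)) (λ l → M row0 j * expTerm (minor M j) l))
  G : Fin (suc (suc k)) → Fin (suc (suc k)) → ℚ
  G j = insertAt (F j) j 0ℚ
  G-off : ∀ {j c} (j≢c : j ≢ c) → G j c ≡ F j (punchOut j≢c)
  G-off {j} j≢c = trans (cong (G j) (sym (FinP.punchIn-punchOut j≢c))) (insertAt-punchIn (F j) j 0ℚ _)
  F-antisym : ∀ {j c} (j≢c : j ≢ c) → F j (punchOut j≢c) ≡ - F c (punchOut (j≢c ∘ sym))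
  F-antisym {j} {c} j≢c = begin
    sj * (M row0 j * (sp * (M row1 (punchIn j p) * D j p)))
      ≡⟨ cong (λ z → sj * (M row0 j * (sp * (M row1 z * D j p)))) (FinP.punchIn-punchOut j≢c) ⟩
    sj * (M row0 j * (sp * (M row1 c * D j p)))
      ≡⟨ solve 5 (λ s t a b d → s :* (a :* (t :* (b :* d))) := (s :* t) :* (a :* b :* d)) refl sj sp (M row0 j) (M row1 c) (D j p) ⟩
    (sj * sp) * (M row0 j * M row1 c * D j p)
      ≡⟨ cong₂ _*_ (sgn-pairAntisym j c j≢c c≢j) (cong₂ _*_ (cong₂ _*_ (row0≡row1 j) (sym (row0≡row1 c))) sameD) ⟩
    (- (sc * sp')) * (M row1 j * M row0 c * D c p')
      ≡⟨ solve 5 (λ s t a b d → (:- (s :* t)) :* (a :* b :* d) := :- (s :* (b :* (t :* (a :* d))))) refl sc sp' (M row1 j) (M row0 c) (D c p') ⟩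
    - (sc * (M row0 c * (sp' * (M row1 j * D c p'))))
      ≡⟨ cong (λ z → - (sc * (M row0 c * (sp' * (M row1 z * D c p'))))) (sym (FinP.punchIn-punchOut c≢j)) ⟩
    - F c p'  ∎
    where
    c≢j = j≢c ∘ sym
    p = punchOut j≢c
    p' = punchOut c≢j
    sj = sgn (toℕ j)
    sc = sgn (toℕ c)
    sp = sgn (toℕ p)
    sp' = sgn (toℕ p')
    sameD : D j p ≡ D c p'
    sameD = det-cong k (λ a b → cong (M (Fin.suc (Fin.suc a))) (punchIn²-comm j c j≢c c≢j b))
  G-antisym : ∀ j c → G j c ≡ - G c j
  G-antisym j c with j FinP.≟ c
  ... | yes refl = trans (insertAt-lookup (F j) j 0ℚ) (cong -_ (sym (insertAt-lookup (F j) j 0ℚ)))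
  ... | no j≢c   = trans (G-off j≢c) (trans (F-antisym j≢c) (cong -_ (sym (G-off (j≢c ∘ sym)))))

-- With
-- D(u, v) = det of M with rows i, i' replaced by u, v, bilinearity gives
-- 0 = D(a+b, a+b) = D(a, a) + D(a, b) + D(b, a) + D(b, b) = D(a, b) + D(b, a).
det-swap : ∀ k → Alternating k → (M M' : Mat k) (i i' : Fin k) → i ≢ i' →
  (∀ r → r ≢ i → r ≢ i' → ∀ c → M' r c ≡ M r c) →
  (∀ c → M' i c ≡ M i' c) → (∀ c → M' i' c ≡ M i c) → det k M' ≡ - det k M
det-swap k alt M M' i i' i≢i' other row-i row-i' = begin
  det k M'   ≡⟨ det-cong k (rows-ext M' (R b a) i i'
                  (λ c → trans (row-i c) (sym (setRows-i M i≢i' b a c)))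
                  (λ c → trans (row-i' c) (sym (setRows-i' M i≢i' b a c)))
                  (λ r r≢i r≢i' c → trans (other r r≢i r≢i' c) (sym (setRows-other M i≢i' b a r r≢i r≢i' c)))) ⟩
  D b a      ≡⟨ inverseʳ-unique (D a b) (D b a) cancel ⟩
  - D a b    ≡⟨ cong -_ (det-cong k (rows-ext (R a b) M i i' (setRows-i M i≢i' a b) (setRows-i' M i≢i' a b)
                  (setRows-other M i≢i' a b))) ⟩
  - det k M  ∎
  where
  open ≡-Reasoning
  a = M i
  b = M i'
  _⊕_ : (u v : Fin k → ℚ) → Fin k → ℚ
  (u ⊕ v) c = u c + v c
  R : (u v : Fin k → ℚ) → Mat k
  R = setRows M i i'
  D : (u v : Fin k → ℚ) → ℚ
  D u v = det k (R u v)
  additiveˡ : ∀ u u' v → D (u ⊕ u') v ≡ D u v + D u' v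
  additiveˡ u u' v = det-rowAdd k i (R (u ⊕ u') v) (R u v) (R u' v) (sameOff u) (sameOff u')
    (λ c → trans (setRows-i M i≢i' (u ⊕ u') v c) (sym (cong₂ _+_ (setRows-i M i≢i' u v c) (setRows-i M i≢i' u' v c))))
    where
    sameOff : ∀ w → SameOff i (R w v) (R (u ⊕ u') v)
    sameOff w r r≢i c = setRow-cong (setRow M i w) (setRow M i (u ⊕ u')) i' v r c
      (trans (setRow-off M i w r r≢i c) (sym (setRow-off M i (u ⊕ u') r r≢i c)))
  additiveʳ : ∀ u v v' → D u (v ⊕ v') ≡ D u v + D u v'
  additiveʳ u v v' = det-rowAdd k i' (R u (v ⊕ v')) (R u v) (R u v') (sameOff v) (sameOff v')
    (λ c → trans (setRows-i' M i≢i' u (v ⊕ v') c) (sym (cong₂ _+_ (setRows-i' M i≢i' u v c) (setRows-i' M i≢i' u v' c))))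
    where
    sameOff : ∀ w → SameOff i' (R u w) (R u (v ⊕ v'))
    sameOff w r r≢i' c = trans (setRow-off (setRow M i u) i' w r r≢i' c) (sym (setRow-off (setRow M i u) i' (v ⊕ v') r r≢i' c))
  vanish : ∀ w → D w w ≡ 0ℚ
  vanish w = alt (R w w) i i' i≢i' (λ c → trans (setRows-i M i≢i' w w c) (sym (setRows-i' M i≢i' w w c)))
  cancel : D a b + D b a ≡ 0ℚ
  cancel = begin
    D a b + D b a                        ≡⟨ solve 2 (λ x y → x :+ y := (con 0ℚ :+ x) :+ (y :+ con 0ℚ)) refl (D a b) (D b a) ⟩
    (0ℚ + D a b) + (D b a + 0ℚ)          ≡⟨ cong₂ (λ z w → (z + D a b) + (D b a + w)) (sym (vanish a)) (sym (vanish b)) ⟩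
    (D a a + D a b) + (D b a + D b b)    ≡⟨ sym (cong₂ _+_ (additiveʳ a a b) (additiveʳ b a b)) ⟩
    D a (a ⊕ b) + D b (a ⊕ b)            ≡⟨ sym (additiveˡ a b (a ⊕ b)) ⟩
    D (a ⊕ b) (a ⊕ b)                    ≡⟨ vanish (a ⊕ b) ⟩
    0ℚ                                   ∎

-- Row 0 equal to row a+1 ⇒ det = 0, if the next smaller size is alternating:
-- exchanging rows 1 and a+1 (inside every minor, hence negating det) reduces
-- to the case of equal rows 0 and 1.
det-equalRow0 : ∀ k → Alternating k → (M : Mat (suc k)) (a : Fin k) →
  (∀ c → M Fin.zero c ≡ M (Fin.suc a) c) → det (suc k) M ≡ 0ℚ
det-equalRow0 (suc k) alt M Fin.zero     row0≡row1 = det-equalRows01 k M row0≡row1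
det-equalRow0 (suc k) alt M (Fin.suc a) row0≡row =
  ℚP.neg-injective (trans (sym swap-negates) (det-equalRows01 k M' (λ c → trans (row0≡row c) (sym (swapped-r₁ c)))))
  where
  open ≡-Reasoning
  r₁ r₂ : Fin (suc (suc k))
  r₁ = Fin.suc Fin.zero
  r₂ = Fin.suc (Fin.suc a)
  r₁≢r₂ : r₁ ≢ r₂
  r₁≢r₂ ()
  M' = setRows M r₁ r₂ (M r₂) (M r₁)
  swapped-r₁ : ∀ c → M' r₁ c ≡ M r₂ c
  swapped-r₁ = setRows-i M r₁≢r₂ (M r₂) (M r₁)
  swapped-other : ∀ r → r ≢ r₁ → r ≢ r₂ → ∀ c → M' r c ≡ M r c
  swapped-other = setRows-other M r₁≢r₂ (M r₂) (M r₁)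
  term : ∀ j → expTerm M' j ≡ - expTerm M j
  term j = begin
    sgn (toℕ j) * (M' Fin.zero j * det (suc k) (minor M' j))
      ≡⟨ cong₂ (λ u v → sgn (toℕ j) * (u * v)) (swapped-other Fin.zero (λ ()) (λ ()) j)
           (det-swap (suc k) alt (minor M j) (minor M' j) Fin.zero (Fin.suc a) (λ ())
             (λ r r≢0 r≢a c → swapped-other (Fin.suc r) (r≢0 ∘ FinP.suc-injective) (r≢a ∘ FinP.suc-injective) (punchIn j c))
             (λ c → swapped-r₁ (punchIn j c)) (λ c → setRows-i' M r₁≢r₂ (M r₂) (M r₁) (punchIn j c))) ⟩
    sgn (toℕ j) * (M Fin.zero j * - det (suc k) (minor M j))
      ≡⟨ solve 3 (λ s m d → s :* (m :* :- d) := :- (s :* (m :* d))) refl (sgn (toℕ j)) (M Fin.zero j) (det (suc k) (minor M j)) ⟩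
    - expTerm M j ∎
  swap-negates : det (suc (suc k)) M' ≡ - det (suc (suc k)) M
  swap-negates = trans (Σ-cong (suc (suc k)) term) (Σ-neg (suc (suc k)) (expTerm M))

det-alternating : ∀ k → Alternating k
det-alternating (suc k) M Fin.zero    Fin.zero    0≢0 _   = ⊥-elim (0≢0 refl)
det-alternating (suc k) M Fin.zero    (Fin.suc a) _   row = det-equalRow0 k (det-alternating k) M a row
det-alternating (suc k) M (Fin.suc a) Fin.zero    _   row = det-equalRow0 k (det-alternating k) M a (sym ∘ row)
det-alternating (suc k) M (Fin.suc a) (Fin.suc b) a≢b row = Σ-zero (suc k) (expTerm M) λ j →
  trans (cong (λ d → sgn (toℕ j) * (M Fin.zero j * d))
              (det-alternating k (minor M j) a b (a≢b ∘ cong Fin.suc) (row ∘ punchIn j)))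
        (solve 2 (λ s m → s :* (m :* con 0ℚ) := con 0ℚ) refl (sgn (toℕ j)) (M Fin.zero j))

det-dependentRow : ∀ k (M : Mat k) (i : Fin k) p (ι : Fin p → Fin k) (coef : Fin p → ℚ) →
  (∀ l → ι l ≢ i) → (∀ c → M i c ≡ sumFin p (λ l → coef l * M (ι l) c)) → det k M ≡ 0ℚ
det-dependentRow k M i zero ι coef ι≢i row =
  trans (det-rowScale k i 0ℚ M M (λ _ _ _ → refl) (λ c → trans (row c) (sym (ℚP.*-zeroˡ (M i c)))))
        (ℚP.*-zeroˡ (det k M))
det-dependentRow k M i (suc p) ι coef ι≢i row = begin
  det k M                                    ≡⟨ det-rowLinear k i (coef Fin.zero) 1ℚ M M₁ M₂ (setRow-off M i _) (setRow-off M i _)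
                                                  (λ c → trans (row c) (cong₂ (λ u v → coef Fin.zero * u + v)
                                                     (sym (setRow-row M i (M ι₀) c)) (sym (trans (ℚP.*-identityˡ _) (setRow-row M i rest c))))) ⟩
  coef Fin.zero * det k M₁ + 1ℚ * det k M₂    ≡⟨ cong₂ (λ u v → coef Fin.zero * u + 1ℚ * v) M₁-vanishes M₂-vanishes ⟩
  coef Fin.zero * 0ℚ + 1ℚ * 0ℚ               ≡⟨ cong (λ z → z + 1ℚ * 0ℚ) (ℚP.*-zeroʳ (coef Fin.zero)) ⟩
  0ℚ                                         ∎
  where
  open ≡-Reasoning
  ι₀ = ι Fin.zero
  rest : Fin k → ℚ
  rest c = sumFin p (λ l → coef (Fin.suc l) * M (ι (Fin.suc l)) c)
  M₁ = setRow M i (M ι₀)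
  M₂ = setRow M i rest
  -- M₁ has equal rows i and ι₀
  M₁-vanishes : det k M₁ ≡ 0ℚ
  M₁-vanishes = det-alternating k M₁ i ι₀ (ι≢i Fin.zero ∘ sym)
    (λ c → trans (setRow-row M i (M ι₀) c) (sym (setRow-off M i (M ι₀) ι₀ (ι≢i Fin.zero) c)))
  -- row i of M₂ is a combination of the remaining p rows
  M₂-vanishes : det k M₂ ≡ 0ℚ
  M₂-vanishes = det-dependentRow k M₂ i p (ι ∘ Fin.suc) (coef ∘ Fin.suc) (ι≢i ∘ Fin.suc)
    (λ c → trans (setRow-row M i rest c)
      (Σ-cong p (λ l → cong (coef (Fin.suc l) *_) (sym (setRow-off M i rest (ι (Fin.suc l)) (ι≢i (Fin.suc l)) c)))))

firstRows : ∀ {N} → ℕ → Mat N → Mat N → Mat N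
firstRows q M' M r c with toℕ r ℕP.<? q
... | yes _ = M' r c
... | no  _ = M r c

module _ {N} (M' M : Mat N) where

  firstRows-< : ∀ q r → toℕ r < q → ∀ c → firstRows q M' M r c ≡ M' r c
  firstRows-< q r r<q c with toℕ r ℕP.<? q
  ... | yes _   = refl
  ... | no  r≮q = ⊥-elim (r≮q r<q)

  firstRows-≥ : ∀ q r → q ≤ toℕ r → ∀ c → firstRows q M' M r c ≡ M r c
  firstRows-≥ q r q≤r c with toℕ r ℕP.<? q
  ... | yes r<q = ⊥-elim (ℕP.<⇒≱ r<q q≤r)
  ... | no  _   = refl

  firstRows-step : ∀ q r → toℕ r ≢ q → ∀ c → firstRows q M' M r c ≡ firstRows (suc q) M' M r c
  firstRows-step q r r≢q c with toℕ r ℕP.<? q | toℕ r ℕP.<? suc q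
  ... | yes _   | yes _    = refl
  ... | yes r<q | no r≮1+q = ⊥-elim (r≮1+q (ℕP.m<n⇒m<1+n r<q))
  ... | no  _   | no _     = refl
  ... | no  r≮q | yes r<1+q with ℕP.m<1+n⇒m<n∨m≡n r<1+q
  ...   | inj₁ r<q = ⊥-elim (r≮q r<q)
  ...   | inj₂ r≡q = ⊥-elim (r≢q r≡q)

det-rowOp : ∀ N (i : Fin N) α (M M' : Mat N) p (ι : Fin p → Fin N) (coef : Fin p → ℚ) →
  (∀ l → ι l ≢ i) → SameOff i M M' →
  (∀ c → M' i c ≡ α * M i c + sumFin p (λ l → coef l * M (ι l) c)) → det N M' ≡ α * det N M
det-rowOp N i α M M' p ι coef ι≢i same row = begin
  det N M'                        ≡⟨ det-rowLinear N i α 1ℚ M' M M″ same (λ r r≢i c → trans (setRow-off M i w r r≢i c) (same r r≢i c))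
                                       (λ c → trans (row c) (cong (λ z → α * M i c + z) (sym (trans (ℚP.*-identityˡ _) (setRow-row M i w c))))) ⟩
  α * det N M + 1ℚ * det N M″     ≡⟨ cong (λ z → α * det N M + 1ℚ * z) M″-vanishes ⟩
  α * det N M + 1ℚ * 0ℚ           ≡⟨ solve 2 (λ a d → a :* d :+ con 1ℚ :* con 0ℚ := a :* d) refl α (det N M) ⟩
  α * det N M                     ∎
  where
  open ≡-Reasoning
  w : Fin N → ℚ
  w c = sumFin p (λ l → coef l * M (ι l) c)
  M″ = setRow M i w
  M″-vanishes : det N M″ ≡ 0ℚ
  M″-vanishes = det-dependentRow N M″ i p ι coef ι≢i (λ c → trans (setRow-row M i w c)
    (Σ-cong p (λ l → cong (coef l *_) (sym (setRow-off M i w (ι l) (ι≢i l) c)))))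

-- Replacing each of the first K rows by α·(that row) plus a combination of
-- rows with index ≥ K multiplies det by α^K: perform the operations one row
-- at a time, the rows ≥ K being untouched throughout.
det-rowOps : ∀ N K α (M M' : Mat N) p (ι : Fin p → Fin N) (coef : Fin N → Fin p → ℚ) →
  K ≤ N → (∀ l → K ≤ toℕ (ι l)) →
  (∀ r → K ≤ toℕ r → ∀ c → M' r c ≡ M r c) →
  (∀ r → toℕ r < K → ∀ c → M' r c ≡ α * M r c + sumFin p (λ l → coef r l * M (ι l) c)) →
  det N M' ≡ α ^ K * det N M
det-rowOps N K α M M' p ι coef K≤N K≤ι kept changed =
  trans (det-cong N fromM') (firstRows-det K ℕP.≤-refl)
  where
  Mq : ℕ → Mat N
  Mq q = firstRows q M' M
  fromM' : ∀ r c → M' r c ≡ Mq K r c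
  fromM' r c with toℕ r ℕP.<? K
  ... | yes _   = refl
  ... | no  r≮K = kept r (ℕP.≮⇒≥ r≮K) c
  firstRows-det : ∀ q → q ≤ K → det N (Mq q) ≡ α ^ q * det N M
  firstRows-det zero    _     = trans (det-cong N (λ r → firstRows-≥ M' M 0 r ℕ.z≤n)) (sym (ℚP.*-identityˡ (det N M)))
  firstRows-det (suc q) 1+q≤K = begin
    det N (Mq (suc q))       ≡⟨ det-rowOp N r α (Mq q) (Mq (suc q)) p ι (coef r) ι≢r
                                  (λ s s≢r → firstRows-step M' M q s (s≢r ∘ index)) rowr ⟩
    α * det N (Mq q)         ≡⟨ cong (α *_) (firstRows-det q (ℕP.<⇒≤ 1+q≤K)) ⟩
    α * (α ^ q * det N M)    ≡⟨ sym (ℚP.*-assoc α (α ^ q) (det N M)) ⟩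
    α ^ suc q * det N M      ∎
    where
    open ≡-Reasoning
    r : Fin N
    r = fromℕ< (ℕP.<-≤-trans 1+q≤K K≤N)
    toℕr≡q : toℕ r ≡ q
    toℕr≡q = FinP.toℕ-fromℕ< (ℕP.<-≤-trans 1+q≤K K≤N)
    index : ∀ {s} → toℕ s ≡ q → s ≡ r
    index s≡q = FinP.toℕ-injective (trans s≡q (sym toℕr≡q))
    ι≥q : ∀ l → q ≤ toℕ (ι l)
    ι≥q l = ℕP.≤-trans (ℕP.n≤1+n q) (ℕP.≤-trans 1+q≤K (K≤ι l))
    ι≢r : ∀ l → ι l ≢ r
    ι≢r l ι≡r = ℕP.<⇒≢ (ℕP.<-≤-trans 1+q≤K (K≤ι l)) (sym (trans (cong toℕ ι≡r) toℕr≡q))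
    rowr : ∀ c → Mq (suc q) r c ≡ α * Mq q r c + sumFin p (λ l → coef r l * Mq q (ι l) c)
    rowr c = begin
      Mq (suc q) r c                                       ≡⟨ firstRows-< M' M (suc q) r (ℕP.≤-reflexive (cong suc toℕr≡q)) c ⟩
      M' r c                                               ≡⟨ changed r (ℕP.<-≤-trans (ℕP.≤-reflexive (cong suc toℕr≡q)) 1+q≤K) c ⟩
      α * M r c + sumFin p (λ l → coef r l * M (ι l) c)    ≡⟨ sym (cong₂ (λ u v → α * u + v) (firstRows-≥ M' M q r (ℕP.≤-reflexive (sym toℕr≡q)) c)
                                                                 (Σ-cong p (λ l → cong (coef r l *_) (firstRows-≥ M' M q (ι l) (ι≥q l) c)))) ⟩
      α * Mq q r c + sumFin p (λ l → coef r l * Mq q (ι l) c) ∎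

punchIn-↑ˡ : ∀ {k} l (j : Fin (suc k)) (b : Fin k) → punchIn (j ↑ˡ l) (b ↑ˡ l) ≡ punchIn j b ↑ˡ l
punchIn-↑ˡ l Fin.zero    b           = refl
punchIn-↑ˡ l (Fin.suc j) Fin.zero    = refl
punchIn-↑ˡ l (Fin.suc j) (Fin.suc b) = cong Fin.suc (punchIn-↑ˡ l j b)

punchIn-↑ʳ : ∀ k l (j : Fin (suc k)) (b : Fin l) → punchIn (j ↑ˡ l) (k ↑ʳ b) ≡ suc k ↑ʳ b
punchIn-↑ʳ k       l Fin.zero    b = refl
punchIn-↑ʳ (suc k) l (Fin.suc j) b = cong Fin.suc (punchIn-↑ʳ k l j b)

det-blockTriangular : ∀ k l (M : Mat (k ℕ.+ l)) → (∀ i j → M (i ↑ˡ l) (k ↑ʳ j) ≡ 0ℚ) →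
  det (k ℕ.+ l) M ≡ det k (λ a b → M (a ↑ˡ l) (b ↑ˡ l)) * det l (λ a b → M (k ↑ʳ a) (k ↑ʳ b))
det-blockTriangular zero    l M upperRight0 = sym (ℚP.*-identityˡ (det l M))
det-blockTriangular (suc k) l M upperRight0 = begin
  sumFin (suc k ℕ.+ l) (expTerm M)                                          ≡⟨ Σ-split (suc k) l (expTerm M) ⟩
  sumFin (suc k) (λ j → expTerm M (j ↑ˡ l)) + sumFin l (λ j → expTerm M (suc k ↑ʳ j))
    ≡⟨ cong₂ _+_ (Σ-cong (suc k) left) (Σ-zero l (λ j → expTerm M (suc k ↑ʳ j)) right) ⟩
  sumFin (suc k) (λ j → expTerm A j * det l B) + 0ℚ                         ≡⟨ ℚP.+-identityʳ _ ⟩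
  sumFin (suc k) (λ j → expTerm A j * det l B)                              ≡⟨ sym (Σ-*ʳ (suc k) (det l B) (expTerm A)) ⟩
  det (suc k) A * det l B                                                   ∎
  where
  open ≡-Reasoning
  A : Mat (suc k)
  A a b = M (a ↑ˡ l) (b ↑ˡ l)
  B : Mat l
  B a b = M (suc k ↑ʳ a) (suc k ↑ʳ b)
  right : ∀ j → expTerm M (suc k ↑ʳ j) ≡ 0ℚ
  right j = trans (cong (λ z → sgn (toℕ (suc k ↑ʳ j)) * (z * det (k ℕ.+ l) (minor M (suc k ↑ʳ j)))) (upperRight0 Fin.zero j))
    (solve 2 (λ s d → s :* (con 0ℚ :* d) := con 0ℚ) refl (sgn (toℕ (suc k ↑ʳ j))) (det (k ℕ.+ l) (minor M (suc k ↑ʳ j))))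
  -- the minor of M at a column of the left block is again block triangular
  left : ∀ j → expTerm M (j ↑ˡ l) ≡ expTerm A j * det l B
  left j = begin
    sgn (toℕ (j ↑ˡ l)) * (A Fin.zero j * det (k ℕ.+ l) (minor M (j ↑ˡ l)))
      ≡⟨ cong₂ (λ u v → sgn u * (A Fin.zero j * v)) (FinP.toℕ-↑ˡ j l)
           (det-blockTriangular k l (minor M (j ↑ˡ l))
             (λ i b → trans (cong (M (Fin.suc (i ↑ˡ l))) (punchIn-↑ʳ k l j b)) (upperRight0 (Fin.suc i) b))) ⟩
    sgn (toℕ j) * (A Fin.zero j * (det k (λ a b → minor M (j ↑ˡ l) (a ↑ˡ l) (b ↑ˡ l)) * det l (λ a b → minor M (j ↑ˡ l) (k ↑ʳ a) (k ↑ʳ b))))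
      ≡⟨ cong₂ (λ u v → sgn (toℕ j) * (A Fin.zero j * (u * v)))
           (det-cong k (λ a b → cong (M (Fin.suc (a ↑ˡ l))) (punchIn-↑ˡ l j b)))
           (det-cong l (λ a b → cong (M (Fin.suc (k ↑ʳ a))) (punchIn-↑ʳ k l j b))) ⟩
    sgn (toℕ j) * (A Fin.zero j * (det k (minor A j) * det l B))
      ≡⟨ solve 4 (λ s t d e → s :* (t :* (d :* e)) := s :* (t :* d) :* e) refl (sgn (toℕ j)) (A Fin.zero j) (det k (minor A j)) (det l B) ⟩
    expTerm A j * det l B ∎

det-scaleAll : ∀ k a (M : Mat k) → det k (λ r c → a * M r c) ≡ a ^ k * det k M
det-scaleAll zero    a M = sym (ℚP.*-identityˡ 1ℚ)
det-scaleAll (suc k) a M = trans (Σ-cong (suc k) term) (sym (Σ-*ˡ (suc k) (a ^ suc k) (expTerm M)))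
  where
  term : ∀ j → expTerm (λ r c → a * M r c) j ≡ a ^ suc k * expTerm M j
  term j = trans (cong (λ z → sgn (toℕ j) * (a * M Fin.zero j * z)) (det-scaleAll k a (minor M j)))
    (solve 5 (λ s a m b d → s :* (a :* m :* (b :* d)) := (a :* b) :* (s :* (m :* d))) refl
       (sgn (toℕ j)) a (M Fin.zero j) (a ^ k) (det k (minor M j)))

module _ {k : ℕ} where

  eqFin-true : {a b : Fin k} → a ≡ b → eqFin a b ≡ true
  eqFin-true {a} {b} a≡b = trans (isYes≗does (a FinP.≟ b)) (dec-true (a FinP.≟ b) a≡b)

  eqFin-false : {a b : Fin k} → a ≢ b → eqFin a b ≡ false
  eqFin-false {a} {b} a≢b = trans (isYes≗does (a FinP.≟ b)) (dec-false (a FinP.≟ b) a≢b)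

  eqFin-sound : {a b : Fin k} → eqFin a b ≡ true → a ≡ b
  eqFin-sound {a} {b} eq with a FinP.≟ b
  ... | yes a≡b = a≡b
  ... | no  _   with eq
  ...   | ()

  eqFin-sym : (a b : Fin k) → eqFin a b ≡ eqFin b a
  eqFin-sym a b with a FinP.≟ b
  ... | yes a≡b = sym (eqFin-true (sym a≡b))
  ... | no  a≢b = sym (eqFin-false (a≢b ∘ sym))

eqFin-inj : ∀ {k k'} (f : Fin k → Fin k') → (∀ {a b} → f a ≡ f b → a ≡ b) →
  ∀ a b → eqFin (f a) (f b) ≡ eqFin a b
eqFin-inj f f-inj a b with a FinP.≟ b
... | yes a≡b = eqFin-true (cong f a≡b)
... | no  a≢b = eqFin-false (a≢b ∘ f-inj)

diag : ℚ → ∀ {k} → Mat k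
diag x i j = if eqFin i j then x else 0ℚ

det-diag : ∀ k x → det k (diag x) ≡ x ^ k
det-diag zero    x = refl
det-diag (suc k) x = begin
  det (suc k) (diag x)                   ≡⟨ Σ-delta (suc k) Fin.zero (expTerm (diag x)) offDiagonal ⟩
  1ℚ * (x * det k (minor (diag x) Fin.zero)) ≡⟨ ℚP.*-identityˡ _ ⟩
  x * det k (minor (diag x) Fin.zero)    ≡⟨ cong (x *_) (det-cong k (λ a b → cong (λ z → if z then x else 0ℚ) (eqFin-inj Fin.suc FinP.suc-injective a b))) ⟩
  x * det k (diag x)                     ≡⟨ cong (x *_) (det-diag k x) ⟩
  x ^ suc k                              ∎
  where
  open ≡-Reasoning
  offDiagonal : ∀ j → j ≢ Fin.zero → expTerm (diag x) j ≡ 0ℚ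
  offDiagonal j j≢0 = trans (cong (λ z → sgn (toℕ j) * ((if z then x else 0ℚ) * det k (minor (diag x) j))) (eqFin-false (j≢0 ∘ sym)))
    (solve 2 (λ s d → s :* (con 0ℚ :* d) := con 0ℚ) refl (sgn (toℕ j)) (det k (minor (diag x) j)))

ones : ∀ {k} → Fin k → ℚ
ones _ = 1ℚ

1^ : ∀ k → 1ℚ ^ k ≡ 1ℚ
1^ zero    = refl
1^ (suc k) = trans (ℚP.*-identityˡ (1ℚ ^ k)) (1^ k)

-- If every column of X sums to t, then det X = t · det X', where X' is X
-- with its last row replaced by ones: adding all other rows to the last
-- one turns it into the constant row t.
det-columnSums : ∀ k (X : Mat (suc k)) t → (∀ c → sumFin (suc k) (λ r → X r c) ≡ t) →
  det (suc k) X ≡ t * det (suc k) (setRow X (fromℕ k) ones)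
det-columnSums k X t colSum = begin
  det (suc k) X                       ≡⟨ sym (trans addOtherRows (ℚP.*-identityˡ (det (suc k) X))) ⟩
  det (suc k) X₁                      ≡⟨ det-rowScale (suc k) L t X₁ (setRow X L ones)
                                           (λ r r≢L c → trans (setRow-off X L ones r r≢L c) (sym (setRow-off X L (λ _ → t) r r≢L c)))
                                           (λ c → trans (setRow-row X L (λ _ → t) c)
                                                    (sym (trans (cong (t *_) (setRow-row X L ones c)) (ℚP.*-identityʳ t)))) ⟩
  t * det (suc k) (setRow X L ones)   ∎
  where
  open ≡-Reasoning
  L = fromℕ k
  X₁ = setRow X L (λ _ → t)
  inject₁≢L : ∀ l → inject₁ l ≢ L
  inject₁≢L l eq = FinP.toℕ-inject₁-≢ l (trans (sym (FinP.toℕ-fromℕ k)) (cong toℕ (sym eq)))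
  lastRow : ∀ c → X₁ L c ≡ 1ℚ * X L c + sumFin k (λ l → 1ℚ * X (inject₁ l) c)
  lastRow c = begin
    X₁ L c                                                ≡⟨ setRow-row X L (λ _ → t) c ⟩
    t                                                     ≡⟨ sym (colSum c) ⟩
    sumFin (suc k) (λ r → X r c)                          ≡⟨ Σ-last k (λ r → X r c) ⟩
    sumFin k (λ l → X (inject₁ l) c) + X L c              ≡⟨ ℚP.+-comm _ (X L c) ⟩
    X L c + sumFin k (λ l → X (inject₁ l) c)              ≡⟨ sym (cong₂ _+_ (ℚP.*-identityˡ (X L c)) (Σ-cong k (λ l → ℚP.*-identityˡ (X (inject₁ l) c)))) ⟩
    1ℚ * X L c + sumFin k (λ l → 1ℚ * X (inject₁ l) c)    ∎
  addOtherRows : det (suc k) X₁ ≡ 1ℚ * det (suc k) X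
  addOtherRows = det-rowOp (suc k) L 1ℚ X X₁ k inject₁ (λ _ → 1ℚ) inject₁≢L
    (λ r r≢L c → sym (setRow-off X L (λ _ → t) r r≢L c)) lastRow

det-plusConstant : ∀ k (P : Mat k) s g → (∀ c → sumFin k (λ r → P r c) ≡ s) →
  det k (λ r c → P r c + g) * s ≡ (s + ℕ→ℚ k * g) * det k P
det-plusConstant zero    P s g _      = solve 2 (λ s g → con 1ℚ :* s := (s :+ con 0ℚ :* g) :* con 1ℚ) refl s g
det-plusConstant (suc k) P s g colSum = begin
  det (suc k) Q * s                   ≡⟨ cong (_* s) (det-columnSums k Q s′ colSumQ) ⟩
  (s′ * det (suc k) Q′) * s           ≡⟨ cong (λ z → (s′ * z) * s) (sym subtractLastRow) ⟩
  (s′ * det (suc k) P′) * s           ≡⟨ solve 3 (λ a b c → (a :* b) :* c := a :* (c :* b)) refl s′ (det (suc k) P′) s ⟩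
  s′ * (s * det (suc k) P′)           ≡⟨ cong (s′ *_) (sym (det-columnSums k P s colSum)) ⟩
  s′ * det (suc k) P                  ∎
  where
  open ≡-Reasoning
  L = fromℕ k
  Q : Mat (suc k)
  Q r c = P r c + g
  s′ = s + ℕ→ℚ (suc k) * g
  colSumQ : ∀ c → sumFin (suc k) (λ r → Q r c) ≡ s′
  colSumQ c = trans (Σ-+ (suc k) (λ r → P r c) (λ _ → g)) (cong₂ _+_ (colSum c) (Σ-const (suc k) g))
  Q′ = setRow Q L ones
  P′ = setRow P L ones
  -- P′ arises from Q′ by subtracting g·(last row) from every other row
  subtractLastRow : det (suc k) P′ ≡ det (suc k) Q′
  subtractLastRow = trans (det-rowOps (suc k) k 1ℚ Q′ P′ 1 (λ _ → L) (λ _ _ → - g) (ℕP.n≤1+n k)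
                             (λ _ → ℕP.≤-reflexive (sym (FinP.toℕ-fromℕ k))) lastRow otherRows)
                          (trans (cong (_* det (suc k) Q′) (1^ k)) (ℚP.*-identityˡ (det (suc k) Q′)))
    where
    lastRow : ∀ r → k ≤ toℕ r → ∀ c → P′ r c ≡ Q′ r c
    lastRow r k≤r c with FinP.toℕ-injective {i = r} {j = L}
                           (trans (ℕP.≤-antisym (FinP.toℕ≤pred[n] r) k≤r) (sym (FinP.toℕ-fromℕ k)))
    ... | refl = trans (setRow-row P L ones c) (sym (setRow-row Q L ones c))
    otherRows : ∀ r → toℕ r < k → ∀ c → P′ r c ≡ 1ℚ * Q′ r c + sumFin 1 (λ _ → - g * Q′ L c)
    otherRows r r<k c = begin
      P′ r c                                    ≡⟨ setRow-off P L ones r r≢L c ⟩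
      P r c                                     ≡⟨ solve 2 (λ p g → p := con 1ℚ :* (p :+ g) :+ ((:- g) :* con 1ℚ :+ con 0ℚ)) refl (P r c) g ⟩
      1ℚ * (P r c + g) + (- g * 1ℚ + 0ℚ)        ≡⟨ cong₂ (λ u v → 1ℚ * u + (- g * v + 0ℚ)) (sym (setRow-off Q L ones r r≢L c)) (sym (setRow-row Q L ones c)) ⟩
      1ℚ * Q′ r c + sumFin 1 (λ _ → - g * Q′ L c) ∎
      where
      r≢L : r ≢ L
      r≢L r≡L = ℕP.<-irrefl (trans (cong toℕ r≡L) (FinP.toℕ-fromℕ k)) r<k

-- Replacing each top row by x·(row) − Σ_e B_e·(row k+e) multiplies det by
-- x^k and clears B; the result is block triangular.
det-schur : ∀ k l x (M : Mat (k ℕ.+ l)) → (∀ e f → M (k ↑ʳ e) (k ↑ʳ f) ≡ diag x e f) →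
  x ^ k * det (k ℕ.+ l) M ≡
  x ^ l * det k (λ v w → x * M (v ↑ˡ l) (w ↑ˡ l) - sumFin l (λ e → M (v ↑ˡ l) (k ↑ʳ e) * M (k ↑ʳ e) (w ↑ˡ l)))
det-schur k l x M scalarBlock = begin
  x ^ k * det (k ℕ.+ l) M        ≡⟨ sym (det-rowOps (k ℕ.+ l) k x M M′ l (k ↑ʳ_) coef (ℕP.m≤m+n k l) lower
                                       (firstRows-≥ R M k) (firstRows-< R M k)) ⟩
  det (k ℕ.+ l) M′               ≡⟨ det-blockTriangular k l M′ cleared ⟩
  det k A′ * det l B′            ≡⟨ cong₂ _*_ (det-cong k complement) (trans (det-cong l scalar′) (det-diag l x)) ⟩
  det k S * x ^ l                ≡⟨ ℚP.*-comm (det k S) (x ^ l) ⟩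
  x ^ l * det k S                ∎
  where
  open ≡-Reasoning
  N = k ℕ.+ l
  S : Mat k
  S v w = x * M (v ↑ˡ l) (w ↑ˡ l) - sumFin l (λ e → M (v ↑ˡ l) (k ↑ʳ e) * M (k ↑ʳ e) (w ↑ˡ l))
  coef : Fin N → Fin l → ℚ
  coef i e = - M i (k ↑ʳ e)
  R : Mat N
  R i c = x * M i c + sumFin l (λ e → coef i e * M (k ↑ʳ e) c)
  M′ = firstRows k R M
  lower : ∀ e → k ≤ toℕ (k ↑ʳ e)
  lower e = ℕP.≤-trans (ℕP.m≤m+n k (toℕ e)) (ℕP.≤-reflexive (sym (FinP.toℕ-↑ʳ k e)))
  upper : ∀ v → toℕ (v ↑ˡ l) < k
  upper v = ℕP.≤-trans (ℕP.≤-reflexive (cong suc (FinP.toℕ-↑ˡ v l))) (FinP.toℕ<n v)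
  A′ : Mat k
  A′ a b = M′ (a ↑ˡ l) (b ↑ˡ l)
  B′ : Mat l
  B′ a b = M′ (k ↑ʳ a) (k ↑ʳ b)
  cleared : ∀ v f → M′ (v ↑ˡ l) (k ↑ʳ f) ≡ 0ℚ
  cleared v f = begin
    M′ (v ↑ˡ l) (k ↑ʳ f)                                      ≡⟨ firstRows-< R M k (v ↑ˡ l) (upper v) (k ↑ʳ f) ⟩
    x * b + sumFin l (λ e → coef (v ↑ˡ l) e * M (k ↑ʳ e) (k ↑ʳ f)) ≡⟨ cong (λ z → x * b + z) (Σ-delta l f _ offDiagonal) ⟩
    x * b + - b * M (k ↑ʳ f) (k ↑ʳ f)                          ≡⟨ cong (λ z → x * b + - b * z) (trans (scalarBlock f f)
                                                                    (cong (λ z → if z then x else 0ℚ) (eqFin-true {a = f} refl))) ⟩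
    x * b + - b * x                                           ≡⟨ solve 2 (λ x b → x :* b :+ (:- b) :* x := con 0ℚ) refl x b ⟩
    0ℚ                                                        ∎
    where
    b = M (v ↑ˡ l) (k ↑ʳ f)
    offDiagonal : ∀ e → e ≢ f → coef (v ↑ˡ l) e * M (k ↑ʳ e) (k ↑ʳ f) ≡ 0ℚ
    offDiagonal e e≢f = trans (cong (coef (v ↑ˡ l) e *_) (trans (scalarBlock e f) (cong (λ z → if z then x else 0ℚ) (eqFin-false e≢f))))
                              (ℚP.*-zeroʳ (coef (v ↑ˡ l) e))
  complement : ∀ v w → A′ v w ≡ S v w
  complement v w = trans (firstRows-< R M k (v ↑ˡ l) (upper v) (w ↑ˡ l))
    (cong (λ z → x * M (v ↑ˡ l) (w ↑ˡ l) + z)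
      (trans (Σ-cong l (λ e → sym (ℚP.neg-distribˡ-* (M (v ↑ˡ l) (k ↑ʳ e)) (M (k ↑ʳ e) (w ↑ˡ l))))) (Σ-neg l _)))
  scalar′ : ∀ a b → B′ a b ≡ diag x a b
  scalar′ a b = trans (firstRows-≥ R M k (k ↑ʳ a) (lower a) (k ↑ʳ b)) (scalarBlock a b)

bool→ℚ-false : ∀ {b} → b ≢ true → bool→ℚ b ≡ 0ℚ
bool→ℚ-false {false} _    = refl
bool→ℚ-false {true}  b≢tt = ⊥-elim (b≢tt refl)

module _ (D : Digraph) where

  -- every ordered pair (v, w) is the arc of at most one e, since `arc` is injective
  Σ-arcIndicator : ∀ v w → sumFin (m D) (λ e → bool→ℚ (eqFin (t D e) v ∧ eqFin (h D e) w)) ≡ bool→ℚ (isArc D v w)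
  Σ-arcIndicator v w with any? (λ e → (t D e FinP.≟ v) ×-dec (h D e FinP.≟ w))
  ... | yes (e₀ , t≡v , h≡w) = trans (Σ-delta (m D) e₀ _ unique) (cong bool→ℚ (cong₂ _∧_ (eqFin-true t≡v) (eqFin-true h≡w)))
    where
    unique : ∀ e → e ≢ e₀ → bool→ℚ (eqFin (t D e) v ∧ eqFin (h D e) w) ≡ 0ℚ
    unique e e≢e₀ = bool→ℚ-false λ isArc-e → e≢e₀ (arc-inj D (cong₂ _,_
      (trans (eqFin-sound (∧-conicalˡ _ _ isArc-e)) (sym t≡v)) (trans (eqFin-sound (∧-conicalʳ _ _ isArc-e)) (sym h≡w))))
  ... | no  none = Σ-zero (m D) _ λ e → bool→ℚ-false λ isArc-e →
    none (e , eqFin-sound (∧-conicalˡ _ _ isArc-e) , eqFin-sound (∧-conicalʳ _ _ isArc-e))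

  Σ-tail : ∀ v → sumFin (m D) (λ e → bool→ℚ (eqFin v (t D e))) ≡ ℕ→ℚ (outdeg D v)
  Σ-tail v = trans (Σ-cong (m D) (λ e → cong bool→ℚ (eqFin-sym v (t D e)))) (Σ-bool (m D) (λ e → eqFin (t D e) v))

  Σ-head : ∀ w → sumFin (m D) (λ e → bool→ℚ (eqFin w (h D e))) ≡ ℕ→ℚ (indeg D w)
  Σ-head w = trans (Σ-cong (m D) (λ e → cong bool→ℚ (eqFin-sym w (h D e)))) (Σ-bool (m D) (λ e → eqFin (h D e) w))

  Σ-atTail : ∀ e (b : Bool) → sumFin (n D) (λ v → bool→ℚ (eqFin (t D e) v ∧ b)) ≡ bool→ℚ b
  Σ-atTail e b = trans (Σ-delta (n D) (t D e) _ (λ v v≢t → cong (λ z → bool→ℚ (z ∧ b)) (eqFin-false (v≢t ∘ sym))))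
                       (cong (λ z → bool→ℚ (z ∧ b)) (eqFin-true {a = t D e} refl))

  Σ-adjColumn : ∀ w → sumFin (n D) (λ v → bool→ℚ (isArc D v w)) ≡ ℕ→ℚ (indeg D w)
  Σ-adjColumn w = begin
    sumFin (n D) (λ v → bool→ℚ (isArc D v w))                                     ≡⟨ Σ-cong (n D) (λ v → sym (Σ-arcIndicator v w)) ⟩
    sumFin (n D) (λ v → sumFin (m D) (λ e → bool→ℚ (eqFin (t D e) v ∧ eqFin (h D e) w))) ≡⟨ Σ-swap (n D) (m D) _ ⟩
    sumFin (m D) (λ e → sumFin (n D) (λ v → bool→ℚ (eqFin (t D e) v ∧ eqFin (h D e) w))) ≡⟨ Σ-cong (m D) (λ e → Σ-atTail e (eqFin (h D e) w)) ⟩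
    sumFin (m D) (λ e → bool→ℚ (eqFin (h D e) w))                                 ≡⟨ Σ-bool (m D) (λ e → eqFin (h D e) w) ⟩
    ℕ→ℚ (indeg D w)                                                               ∎
    where open ≡-Reasoning

  -- every arc has exactly one tail: the out-degrees sum to m
  Σ-outdeg : sumFin (n D) (λ v → ℕ→ℚ (outdeg D v)) ≡ ℕ→ℚ (m D)
  Σ-outdeg = begin
    sumFin (n D) (λ v → ℕ→ℚ (outdeg D v))                          ≡⟨ Σ-cong (n D) (λ v → sym (Σ-bool (m D) (λ e → eqFin (t D e) v))) ⟩
    sumFin (n D) (λ v → sumFin (m D) (λ e → bool→ℚ (eqFin (t D e) v))) ≡⟨ Σ-swap (n D) (m D) _ ⟩
    sumFin (m D) (λ e → sumFin (n D) (λ v → bool→ℚ (eqFin (t D e) v))) ≡⟨ Σ-cong (m D) (λ e → trans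
                                                                          (Σ-cong (n D) (λ v → cong bool→ℚ (sym (∧-identityʳ (eqFin (t D e) v))))) (Σ-atTail e true)) ⟩
    sumFin (m D) (λ _ → 1ℚ)                                        ≡⟨ Σ-const (m D) 1ℚ ⟩
    ℕ→ℚ (m D) * 1ℚ                                                 ≡⟨ ℚP.*-identityʳ (ℕ→ℚ (m D)) ⟩
    ℕ→ℚ (m D)                                                      ∎
    where open ≡-Reasoning

  diagonal-noArc : ∀ v w → eqFin v w ∧ isArc D v w ≡ false
  diagonal-noArc v w with v FinP.≟ w
  ... | no  _    = refl
  ... | yes refl with any? (λ e → (t D e FinP.≟ v) ×-dec (h D e FinP.≟ v))
  ...   | yes (e , t≡v , h≡v) = ⊥-elim (loopless D e (trans t≡v (sym h≡v)))
  ...   | no  _               = refl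

-- the (e-th term of the) product of the two off-diagonal blocks of
-- x·I − A(D^{-0-}):  [v ≠ t(e)]·[w ≠ h(e)] by inclusion–exclusion
offBlockProduct : ∀ (a b : Bool) →
  (0ℚ - bool→ℚ (not a)) * (0ℚ - bool→ℚ (not b)) ≡ ((1ℚ - bool→ℚ a) - bool→ℚ b) + bool→ℚ (a ∧ b)
offBlockProduct true  true  = refl
offBlockProduct true  false = refl
offBlockProduct false true  = refl
offBlockProduct false false = refl

-- With d = [v = w], a = [(v, w) ∈ E] (never both true), K the part of
-- Σ_e B_ve C_ew not depending on a, and (1 − x) y = x² + x, the Schur
-- complement entry equals (1 − x)(y d − a) − K − x.
complementEntry : ∀ (d a : Bool) → d ∧ a ≡ false → ∀ x y K → (1ℚ - x) * y ≡ x * x + x →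
  x * ((if d then x else 0ℚ) - bool→ℚ (not d ∧ not a)) - (K + bool→ℚ a)
    ≡ (1ℚ - x) * ((if d then y else 0ℚ) - bool→ℚ a) + (- K - x)
complementEntry true  false _ x y K y-spec = begin
  x * (x - 0ℚ) - (K + 0ℚ)           ≡⟨ solve 2 (λ x K → x :* (x :- con 0ℚ) :- (K :+ con 0ℚ) := (x :* x :+ x) :+ (:- K :- x)) refl x K ⟩
  (x * x + x) + (- K - x)           ≡⟨ cong (λ z → z + (- K - x)) (sym y-spec) ⟩
  (1ℚ - x) * y + (- K - x)          ≡⟨ solve 3 (λ x y K → (con 1ℚ :- x) :* y :+ (:- K :- x) := (con 1ℚ :- x) :* (y :- con 0ℚ) :+ (:- K :- x)) refl x y K ⟩
  (1ℚ - x) * (y - 0ℚ) + (- K - x)   ∎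
  where open ≡-Reasoning
complementEntry false true  _ x y K _ =
  solve 2 (λ x K → x :* (con 0ℚ :- con 0ℚ) :- (K :+ con 1ℚ) := (con 1ℚ :- x) :* (con 0ℚ :- con 1ℚ) :+ (:- K :- x)) refl x K
complementEntry false false _ x y K _ =
  solve 2 (λ x K → x :* (con 0ℚ :- con 1ℚ) :- (K :+ con 0ℚ) := (con 1ℚ :- x) :* (con 0ℚ :- con 0ℚ) :+ (:- K :- x)) refl x K

module Subdivision (D : Digraph) (r : ℕ) (regular : Regular r D) (x : ℚ) (1-x≢0 : 1ℚ - x ≢ 0ℚ) where

  R Nq Mq : ℚ
  R = ℕ→ℚ r
  Nq = ℕ→ℚ (n D)
  Mq = ℕ→ℚ (m D)

  y : ℚ
  y = ((x * x + x) ÷ (1ℚ - x)) {{≢-nonZero 1-x≢0}}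

  y-spec : (1ℚ - x) * y ≡ x * x + x
  y-spec = begin
    (1ℚ - x) * ((x * x + x) * u)  ≡⟨ solve 3 (λ a b c → a :* (b :* c) := b :* (a :* c)) refl (1ℚ - x) (x * x + x) u ⟩
    (x * x + x) * ((1ℚ - x) * u)  ≡⟨ cong ((x * x + x) *_) (ℚP.*-inverseʳ (1ℚ - x) {{≢-nonZero 1-x≢0}}) ⟩
    (x * x + x) * 1ℚ              ≡⟨ ℚP.*-identityʳ _ ⟩
    x * x + x                     ∎
    where
    open ≡-Reasoning
    u = (1/ (1ℚ - x)) {{≢-nonZero 1-x≢0}}

  X : Mat (n D ℕ.+ m D)
  X i j = (if eqFin i j then x else 0ℚ) - bool→ℚ (adjM0M D i j)

  V : Fin (n D) → Fin (n D ℕ.+ m D)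
  V v = v ↑ˡ m D
  A : Fin (m D) → Fin (n D ℕ.+ m D)
  A e = n D ↑ʳ e

  V≢A : ∀ v e → V v ≢ A e
  V≢A v e Vv≡Ae = ℕP.<⇒≢ (ℕP.<-≤-trans (FinP.toℕ<n v) (ℕP.m≤m+n (n D) (toℕ e)))
    (trans (sym (FinP.toℕ-↑ˡ v (m D))) (trans (cong toℕ Vv≡Ae) (FinP.toℕ-↑ʳ (n D) e)))

  X-VV : ∀ v w → X (V v) (V w) ≡ (if eqFin v w then x else 0ℚ) - bool→ℚ (not (eqFin v w) ∧ not (isArc D v w))
  X-VV v w rewrite eqFin-inj V (FinP.↑ˡ-injective (m D) _ _) v w
                 | FinP.splitAt-↑ˡ (n D) v (m D) | FinP.splitAt-↑ˡ (n D) w (m D) = refl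
  X-VA : ∀ v e → X (V v) (A e) ≡ 0ℚ - bool→ℚ (not (eqFin v (t D e)))
  X-VA v e rewrite eqFin-false (V≢A v e) | FinP.splitAt-↑ˡ (n D) v (m D) | FinP.splitAt-↑ʳ (n D) (m D) e = refl
  X-AV : ∀ e w → X (A e) (V w) ≡ 0ℚ - bool→ℚ (not (eqFin w (h D e)))
  X-AV e w rewrite eqFin-false (V≢A w e ∘ sym) | FinP.splitAt-↑ʳ (n D) (m D) e | FinP.splitAt-↑ˡ (n D) w (m D) = refl
  X-AA : ∀ e f → X (A e) (A f) ≡ diag x e f
  X-AA e f rewrite eqFin-inj A (FinP.↑ʳ-injective (n D) _ _) e f
                 | FinP.splitAt-↑ʳ (n D) (m D) e | FinP.splitAt-↑ʳ (n D) (m D) f = ℚP.+-identityʳ _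

  S : Mat (n D)
  S v w = x * X (V v) (V w) - sumFin (m D) (λ e → X (V v) (A e) * X (A e) (V w))

  schur : x ^ n D * charPolyM0M D x ≡ x ^ m D * det (n D) S
  schur = det-schur (n D) (m D) x X X-AA

  K g s : ℚ
  K = (Mq - R) - R
  g = - K - x
  s = (x * x + x * (R + 1ℚ)) - R

  P : Mat (n D)
  P v w = (1ℚ - x) * ((if eqFin v w then y else 0ℚ) - bool→ℚ (adj D v w))

  -- Σ_e [v ≠ t(e)]·[w ≠ h(e)] = m − outdeg v − indeg w + [(v, w) ∈ E]
  Σ-offBlocks : ∀ v w → sumFin (m D) (λ e → X (V v) (A e) * X (A e) (V w)) ≡ K + bool→ℚ (isArc D v w)
  Σ-offBlocks v w = begin
    sumFin (m D) (λ e → X (V v) (A e) * X (A e) (V w))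
      ≡⟨ Σ-cong (m D) (λ e → trans (cong₂ _*_ (X-VA v e) (X-AV e w)) (offBlockProduct (eqFin v (t D e)) (eqFin w (h D e)))) ⟩
    sumFin (m D) (λ e → ((1ℚ - tail e) - head e) + both e)
      ≡⟨ trans (Σ-+ (m D) _ both) (cong (λ z → z + sumFin (m D) both)
           (trans (Σ-- (m D) _ head) (cong (λ z → z - sumFin (m D) head) (Σ-- (m D) (λ _ → 1ℚ) tail)))) ⟩
    ((sumFin (m D) (λ _ → 1ℚ) - sumFin (m D) tail) - sumFin (m D) head) + sumFin (m D) both
      ≡⟨ cong₂ _+_ (cong₂ _-_ (cong₂ _-_ (trans (Σ-const (m D) 1ℚ) (ℚP.*-identityʳ Mq))
                                         (trans (Σ-tail D v) (cong ℕ→ℚ (proj₁ (regular v)))))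
                              (trans (Σ-head D w) (cong ℕ→ℚ (proj₂ (regular w)))))
                   (trans (Σ-cong (m D) (λ e → cong bool→ℚ (cong₂ _∧_ (eqFin-sym v (t D e)) (eqFin-sym w (h D e)))))
                          (Σ-arcIndicator D v w)) ⟩
    K + bool→ℚ (isArc D v w) ∎
    where
    open ≡-Reasoning
    tail head both : Fin (m D) → ℚ
    tail e = bool→ℚ (eqFin v (t D e))
    head e = bool→ℚ (eqFin w (h D e))
    both e = bool→ℚ (eqFin v (t D e) ∧ eqFin w (h D e))

  S-entry : ∀ v w → S v w ≡ P v w + g
  S-entry v w = trans (cong₂ (λ a b → x * a - b) (X-VV v w) (Σ-offBlocks v w))
    (complementEntry (eqFin v w) (isArc D v w) (diagonal-noArc D v w) x y K y-spec)

  -- every column of P sums to (1 − x)(y − r) = s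
  P-columns : ∀ w → sumFin (n D) (λ v → P v w) ≡ s
  P-columns w = begin
    sumFin (n D) (λ v → P v w)                 ≡⟨ sym (Σ-*ˡ (n D) (1ℚ - x) _) ⟩
    (1ℚ - x) * sumFin (n D) (λ v → δ v - a v)  ≡⟨ cong ((1ℚ - x) *_) (trans (Σ-- (n D) δ a) (cong₂ _-_ Σ-δ Σ-a)) ⟩
    (1ℚ - x) * (y - R)                         ≡⟨ solve 3 (λ x y R → (con 1ℚ :- x) :* (y :- R) := (con 1ℚ :- x) :* y :+ (x :* R :- R)) refl x y R ⟩
    (1ℚ - x) * y + (x * R - R)                 ≡⟨ cong (λ z → z + (x * R - R)) y-spec ⟩
    (x * x + x) + (x * R - R)                  ≡⟨ solve 2 (λ x R → (x :* x :+ x) :+ (x :* R :- R) := (x :* x :+ x :* (R :+ con 1ℚ)) :- R) refl x R ⟩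
    s                                          ∎
    where
    open ≡-Reasoning
    δ a : Fin (n D) → ℚ
    δ v = if eqFin v w then y else 0ℚ
    a v = bool→ℚ (adj D v w)
    Σ-δ : sumFin (n D) δ ≡ y
    Σ-δ = trans (Σ-delta (n D) w δ (λ v v≢w → cong (λ z → if z then y else 0ℚ) (eqFin-false v≢w)))
                (cong (λ z → if z then y else 0ℚ) (eqFin-true {a = w} refl))
    Σ-a : sumFin (n D) a ≡ R
    Σ-a = trans (Σ-adjColumn D w) (cong ℕ→ℚ (proj₂ (regular w)))

  det-P : det (n D) P ≡ (1ℚ - x) ^ n D * charPoly D y
  det-P = det-scaleAll (n D) (1ℚ - x) _

  handshake : Mq ≡ Nq * R
  handshake = trans (sym (Σ-outdeg D)) (trans (Σ-cong (n D) (λ v → cong ℕ→ℚ (proj₁ (regular v)))) (Σ-const (n D) R))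

  num : ℚ
  num = (x * x - x * (Nq - R - 1ℚ)) + ((ℕ→ℚ 2 * Mq - Mq * Nq) - R)

  numerator : s + Nq * g ≡ num
  numerator = begin
    s + Nq * g                                                     ≡⟨ solve 4 (λ x R N M →
        ((x :* x :+ x :* (R :+ con 1ℚ)) :- R) :+ N :* (:- ((M :- R) :- R) :- x)
          := (x :* x :- x :* (N :- R :- con 1ℚ)) :+ ((con (ℕ→ℚ 2) :* (N :* R) :- M :* N) :- R)) refl x R Nq Mq ⟩
    (x * x - x * (Nq - R - 1ℚ)) + ((ℕ→ℚ 2 * (Nq * R) - Mq * Nq) - R) ≡⟨ cong (λ z → (x * x - x * (Nq - R - 1ℚ)) + ((ℕ→ℚ 2 * z - Mq * Nq) - R)) (sym handshake) ⟩
    (x * x - x * (Nq - R - 1ℚ)) + ((ℕ→ℚ 2 * Mq - Mq * Nq) - R)      ∎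
    where open ≡-Reasoning

  cleared : x ^ n D * charPolyM0M D x * s ≡ x ^ m D * (num * ((1ℚ - x) ^ n D * charPoly D y))
  cleared = begin
    x ^ n D * charPolyM0M D x * s                 ≡⟨ cong (_* s) schur ⟩
    x ^ m D * det (n D) S * s                     ≡⟨ cong (λ z → x ^ m D * z * s) (det-cong (n D) S-entry) ⟩
    x ^ m D * det (n D) (λ v w → P v w + g) * s   ≡⟨ ℚP.*-assoc (x ^ m D) _ s ⟩
    x ^ m D * (det (n D) (λ v w → P v w + g) * s) ≡⟨ cong (x ^ m D *_) (det-plusConstant (n D) P s g P-columns) ⟩
    x ^ m D * ((s + Nq * g) * det (n D) P)        ≡⟨ cong₂ (λ u v → x ^ m D * (u * v)) numerator det-P ⟩
    x ^ m D * (num * ((1ℚ - x) ^ n D * charPoly D y)) ∎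
    where open ≡-Reasoning

*-cancelʳ : ∀ a b c → c ≢ 0ℚ → a * c ≡ b * c → a ≡ b
*-cancelʳ a b c c≢0 ac≡bc = begin
  a                ≡⟨ sym (ℚP.*-identityʳ a) ⟩
  a * 1ℚ           ≡⟨ cong (a *_) (sym (ℚP.*-inverseʳ c {{≢-nonZero c≢0}})) ⟩
  a * (c * c⁻¹)    ≡⟨ sym (ℚP.*-assoc a c c⁻¹) ⟩
  a * c * c⁻¹      ≡⟨ cong (_* c⁻¹) ac≡bc ⟩
  b * c * c⁻¹      ≡⟨ ℚP.*-assoc b c c⁻¹ ⟩
  b * (c * c⁻¹)    ≡⟨ cong (b *_) (ℚP.*-inverseʳ c {{≢-nonZero c≢0}}) ⟩
  b * 1ℚ           ≡⟨ ℚP.*-identityʳ b ⟩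
  b                ∎
  where
  open ≡-Reasoning
  c⁻¹ = (1/ c) {{≢-nonZero c≢0}}

module _ (x : ℚ) (x≢0 : x ≢ 0ℚ) where

  private
    x⁻¹ = (1/ x) {{≢-nonZero x≢0}}

  ^-inverse : ∀ k → x ^ k * x⁻¹ ^ k ≡ 1ℚ
  ^-inverse zero    = refl
  ^-inverse (suc k) = begin
    x * x ^ k * (x⁻¹ * x⁻¹ ^ k)     ≡⟨ solve 4 (λ a b c d → a :* b :* (c :* d) := (a :* c) :* (b :* d)) refl x (x ^ k) x⁻¹ (x⁻¹ ^ k) ⟩
    (x * x⁻¹) * (x ^ k * x⁻¹ ^ k)   ≡⟨ cong₂ _*_ (ℚP.*-inverseʳ x {{≢-nonZero x≢0}}) (^-inverse k) ⟩
    1ℚ                              ∎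
    where open ≡-Reasoning

  ^-nonZero : ∀ k → x ^ k ≢ 0ℚ
  ^-nonZero k xᵏ≡0 with trans (sym (^-inverse k)) (trans (cong (_* x⁻¹ ^ k) xᵏ≡0) (ℚP.*-zeroˡ (x⁻¹ ^ k)))
  ... | ()

  ^-powℤ-⊖ : ∀ l k → x ^ k * powℤ x x≢0 (l ⊖ k) ≡ x ^ l
  ^-powℤ-⊖ l       zero    = trans (cong (λ z → 1ℚ * powℤ x x≢0 z) (ℤP.⊖-≥ {l} {0} ℕ.z≤n)) (ℚP.*-identityˡ (x ^ l))
  ^-powℤ-⊖ zero    (suc k) = ^-inverse (suc k)
  ^-powℤ-⊖ (suc l) (suc k) = begin
    x * x ^ k * powℤ x x≢0 (suc l ⊖ suc k)   ≡⟨ cong (λ z → x * x ^ k * powℤ x x≢0 z) (ℤP.[1+m]⊖[1+n]≡m⊖n l k) ⟩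
    x * x ^ k * powℤ x x≢0 (l ⊖ k)           ≡⟨ ℚP.*-assoc x (x ^ k) (powℤ x x≢0 (l ⊖ k)) ⟩
    x * (x ^ k * powℤ x x≢0 (l ⊖ k))         ≡⟨ cong (x *_) (^-powℤ-⊖ l k) ⟩
    x * x ^ l                                ∎
    where open ≡-Reasoning

  -- the same with l ⊖ k written as + l − + k, as in the theorem
  ^-powℤ : ∀ l k → x ^ k * powℤ x x≢0 (+ l -ℤ + k) ≡ x ^ l
  ^-powℤ l k = trans (cong (λ z → x ^ k * powℤ x x≢0 z) (ℤP.m-n≡m⊖n l k)) (^-powℤ-⊖ l k)

  solveFor : ∀ k l s (s≢0 : s ≢ 0ℚ) Z N Q C → x ^ k * Z * s ≡ x ^ l * (N * (Q * C)) →
    Z ≡ powℤ x x≢0 (+ l -ℤ + k) * Q * (N ÷ s) {{≢-nonZero s≢0}} * C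
  solveFor k l s s≢0 Z N Q C eq = *-cancelʳ Z rhs (x ^ k * s) xᵏs≢0 (begin
    Z * (x ^ k * s)                   ≡⟨ solve 3 (λ z a b → z :* (a :* b) := a :* z :* b) refl Z (x ^ k) s ⟩
    x ^ k * Z * s                     ≡⟨ eq ⟩
    x ^ l * (N * (Q * C))             ≡⟨ sym (ℚP.*-identityʳ _) ⟩
    x ^ l * (N * (Q * C)) * 1ℚ        ≡⟨ cong₂ (λ u v → u * (N * (Q * C)) * v) (sym (^-powℤ l k)) (sym (ℚP.*-inverseˡ s {{≢-nonZero s≢0}})) ⟩
    x ^ k * p * (N * (Q * C)) * (s⁻¹ * s)
                                      ≡⟨ solve 7 (λ a p n q c i s → a :* p :* (n :* (q :* c)) :* (i :* s) := p :* q :* (n :* i) :* c :* (a :* s))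
                                           refl (x ^ k) p N Q C s⁻¹ s ⟩
    rhs * (x ^ k * s)                 ∎)
    where
    open ≡-Reasoning
    p = powℤ x x≢0 (+ l -ℤ + k)
    s⁻¹ = (1/ s) {{≢-nonZero s≢0}}
    rhs = p * Q * (N ÷ s) {{≢-nonZero s≢0}} * C
    xᵏs≢0 : x ^ k * s ≢ 0ℚ
    xᵏs≢0 xᵏs≡0 = s≢0 (*-cancelʳ s 0ℚ (x ^ k) (^-nonZero k)
                   (trans (ℚP.*-comm s (x ^ k)) (trans xᵏs≡0 (sym (ℚP.*-zeroˡ (x ^ k))))))

theorem5p5 : (D : Digraph) (r : ℕ) → Regular r D →
    (x : ℚ) (hx : x ≢ 0ℚ) (h1 : 1ℚ - x ≢ 0ℚ)
    (hden : (x * x + x * (ℕ→ℚ r + 1ℚ)) - ℕ→ℚ r ≢ 0ℚ) →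
    charPolyM0M D x ≡
      powℤ x hx (+ m D -ℤ + n D) * ((1ℚ - x) ^ n D) *
      (((x * x - x * (ℕ→ℚ (n D) - ℕ→ℚ r - 1ℚ)) + ((ℕ→ℚ 2 * ℕ→ℚ (m D) - ℕ→ℚ (m D) * ℕ→ℚ (n D)) - ℕ→ℚ r))
        ÷ ((x * x + x * (ℕ→ℚ r + 1ℚ)) - ℕ→ℚ r)) {{≢-nonZero hden}}
      * charPoly D (((x * x + x) ÷ (1ℚ - x)) {{≢-nonZero h1}})
theorem5p5 D r regular x hx h1 hden =
  solveFor x hx (n D) (m D) s hden (charPolyM0M D x) num ((1ℚ - x) ^ n D) (charPoly D y) cleared
  where open Subdivision D r regular x h1
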